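{- For every positive integer $n$, the number of maximal sets of lanes (MSL) of the restricted standard road intersection of size $n$ equals $L_n$.
   Context: For $n\ge 0$, $[n]=\{1,\dots,n\}$. A partition $\pi$ of $[n]$ is noncrossing if there are no two distinct blocks $A,B$ of $\pi$ and elements $a<b$ in $A$, $c<d$ in $B$ with $a<c<b<d$. A noncrossing partition $\pi$ of $[n]$ is a marriageable singles partition if it has two distinct singleton blocks $\{i\},\{j\}$ ($i\ne j$) such that replacing these two blocks by the block $\{i,j\}$ yields a noncrossing partition; otherwise it is a lonely singles partition. $L_n$ is the number of lonely singles partitions of $[n]$. The standard road intersection of size $n$ consists of $2n$ distinct points on a circle, labelled in clockwise order $E_1,X_1,E_2,X_2,\dots,E_n,X_n$ (entries $E_i$ and exits $X_i$ alternate). A lane is a straight chord $E_iX_j$ from an entry to an exit; a lane $E_iX_i$ is a U-turn. In the restricted standard road intersection of size $n$, U-turns are forbidden, so the only admissible lanes are $E_iX_j$ with $i\ne j$. Two lanes cross if they have a common point (including a common endpoint). A maximal set of lanes (MSL) of the restricted intersection is a set of pairwise noncrossing admissible lanes such that every further admissible lane crosses at least one of them. -}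

module Defs where

open import Data.Nat using (ℕ; zero; suc; _*_; _<_; _⊓_; _⊔_)
open import Data.Nat.Properties using (_<?_)
open import Data.Bool using (Bool; true; false)
open import Data.Bool.Properties using () renaming (_≟_ to _≟ᵇ_)
open import Data.Fin using (Fin; toℕ) renaming (_≟_ to _≟ᶠ_)
open import Data.Fin.Properties using (all?; any?)
open import Data.Vec using (Vec; lookup; []; _∷_)
open import Data.List using (List; []; _∷_; length; filter; concatMap; map)
open import Data.Product using (_×_; _,_; ∃)
open import Data.Sum using (_⊎_)
open import Relation.Nullary using (¬_; Dec)
open import Relation.Nullary.Decidable using (¬?; _×-dec_; _⊎-dec_; _→-dec_)
open import Relation.Unary using (Pred; Decidable)
open import Relation.Binary.PropositionalEquality using (_≡_)
import Agda.Primitive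

vecs : {A : Set} → List A → (n : ℕ) → List (Vec A n)
vecs xs zero    = [] ∷ []
vecs xs (suc n) = concatMap (λ x → map (x ∷_) (vecs xs n)) xs

BoolMatrix : ℕ → Set
BoolMatrix n = Vec (Vec Bool n) n

allMatrices : (n : ℕ) → List (BoolMatrix n)
allMatrices n = vecs (vecs (true ∷ false ∷ []) n) n

count : {A : Set} {P : Pred A Agda.Primitive.lzero} → Decidable P → List A → ℕ
count P? xs = length (filter P? xs)

Entry : {n : ℕ} → BoolMatrix n → Fin n → Fin n → Set
Entry M i j = lookup (lookup M i) j ≡ true

entry? : {n : ℕ} (M : BoolMatrix n) (i j : Fin n) → Dec (Entry M i j)
entry? M i j = lookup (lookup M i) j ≟ᵇ true

-- Indices are 0-based: E_{i+1} is at circle position 2i, X_{j+1} at 2j+1,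
-- positions 0,1,...,2n-1 listed in clockwise order.
-- A lane E_{i+1} X_{j+1} is the pair (i , j).

entryPt : {n : ℕ} → Fin n → ℕ
entryPt i = 2 * toℕ i

exitPt : {n : ℕ} → Fin n → ℕ
exitPt j = suc (2 * toℕ j)

Interleave : ℕ → ℕ → ℕ → ℕ → Set
Interleave a b c d = (a < c × c < b × b < d) ⊎ (c < a × a < d × d < b)

-- two lanes cross: they share an endpoint, or their chords intersect in
-- the interior of the disc (i.e. the endpoints interleave on the circle)
LanesCross : {n : ℕ} → Fin n → Fin n → Fin n → Fin n → Set
LanesCross i j k l =
  i ≡ k ⊎ j ≡ l ⊎
  Interleave (entryPt i ⊓ exitPt j) (entryPt i ⊔ exitPt j)
             (entryPt k ⊓ exitPt l) (entryPt k ⊔ exitPt l)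

-- a set of lanes is a Boolean matrix S; lane (i , j) belongs to S iff Entry S i j
-- Maximal set of lanes of the restricted intersection (U-turns forbidden)
IsMSL : {n : ℕ} → BoolMatrix n → Set
IsMSL S =
  -- only admissible lanes (no U-turns)
  (∀ i j → Entry S i j → ¬ i ≡ j) ×
  (∀ i j k l → Entry S i j → Entry S k l → ¬ (i ≡ k × j ≡ l) →
     ¬ LanesCross i j k l) ×
  (∀ i j → ¬ i ≡ j → ¬ Entry S i j →
     ∃ λ k → ∃ λ l → Entry S k l × LanesCross i j k l)

-- Set partitions of [n], encoded as equivalence relations on Fin n
-- (x and y in the same block iff R x y).

IsEquivRel : {n : ℕ} → (Fin n → Fin n → Set) → Set
IsEquivRel R =
  (∀ x → R x x) × (∀ x y → R x y → R y x) × (∀ x y z → R x y → R y z → R x z)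

NonCrossing : {n : ℕ} → (Fin n → Fin n → Set) → Set
NonCrossing R =
  ∀ a b c d → toℕ a < toℕ c → toℕ c < toℕ b → toℕ b < toℕ d →
    ¬ (R a b × R c d × ¬ R a c)

Singleton : {n : ℕ} → (Fin n → Fin n → Set) → Fin n → Set
Singleton R i = ∀ x → R i x → x ≡ i

Merge : {n : ℕ} → (Fin n → Fin n → Set) → Fin n → Fin n → Fin n → Fin n → Set
Merge R i j x y = R x y ⊎ (x ≡ i × y ≡ j) ⊎ (x ≡ j × y ≡ i)

Marriageable : {n : ℕ} → (Fin n → Fin n → Set) → Set
Marriageable R =
  ∃ λ i → ∃ λ j → ¬ i ≡ j × Singleton R i × Singleton R j × NonCrossing (Merge R i j)

IsLonely : {n : ℕ} → BoolMatrix n → Set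
IsLonely M = IsEquivRel (Entry M) × NonCrossing (Entry M) × ¬ Marriageable (Entry M)

private
  lanesCross? : {n : ℕ} (i j k l : Fin n) → Dec (LanesCross i j k l)
  lanesCross? i j k l =
    (i ≟ᶠ k) ⊎-dec (j ≟ᶠ l) ⊎-dec
      ((a <? c ×-dec c <? b ×-dec b <? d) ⊎-dec (c <? a ×-dec a <? d ×-dec d <? b))
    where
    a = entryPt i ⊓ exitPt j
    b = entryPt i ⊔ exitPt j
    c = entryPt k ⊓ exitPt l
    d = entryPt k ⊔ exitPt l

  nonCrossing? : {n : ℕ} (R : Fin n → Fin n → Set) → (∀ x y → Dec (R x y)) →
                 Dec (NonCrossing R)
  nonCrossing? R R? =
    all? λ a → all? λ b → all? λ c → all? λ d →
      (toℕ a <? toℕ c) →-dec (toℕ c <? toℕ b) →-dec (toℕ b <? toℕ d) →-dec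
        ¬? (R? a b ×-dec R? c d ×-dec ¬? (R? a c))

  singleton? : {n : ℕ} (R : Fin n → Fin n → Set) → (∀ x y → Dec (R x y)) →
               ∀ i → Dec (Singleton R i)
  singleton? R R? i = all? λ x → R? i x →-dec (x ≟ᶠ i)

isMSL? : {n : ℕ} → Decidable (IsMSL {n})
isMSL? S =
  (all? λ i → all? λ j → entry? S i j →-dec ¬? (i ≟ᶠ j)) ×-dec
  (all? λ i → all? λ j → all? λ k → all? λ l →
     entry? S i j →-dec entry? S k l →-dec ¬? (i ≟ᶠ k ×-dec j ≟ᶠ l) →-dec
       ¬? (lanesCross? i j k l)) ×-dec
  (all? λ i → all? λ j → ¬? (i ≟ᶠ j) →-dec ¬? (entry? S i j) →-dec
     any? λ k → any? λ l → entry? S k l ×-dec lanesCross? i j k l)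

isLonely? : {n : ℕ} → Decidable (IsLonely {n})
isLonely? M =
  ((all? λ x → E? x x) ×-dec
   (all? λ x → all? λ y → E? x y →-dec E? y x) ×-dec
   (all? λ x → all? λ y → all? λ z → E? x y →-dec E? y z →-dec E? x z)) ×-dec
  nonCrossing? (Entry M) E? ×-dec
  ¬? (any? λ i → any? λ j →
        ¬? (i ≟ᶠ j) ×-dec singleton? (Entry M) E? i ×-dec singleton? (Entry M) E? j ×-dec
        nonCrossing? (Merge (Entry M) i j)
          (λ x y → E? x y ⊎-dec (x ≟ᶠ i ×-dec y ≟ᶠ j) ⊎-dec (x ≟ᶠ j ×-dec y ≟ᶠ i)))
  where
  E? = entry? M

numMSL : ℕ → ℕ
numMSL n = count (isMSL? {n}) (allMatrices n)

L : ℕ → ℕ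
L n = count (isLonely? {n}) (allMatrices n)

{-# OPTIONS --safe #-}
module Submission where

-- A lonely singles partition R is sent to the set of lanes E_i X_j in which j is the cyclic
-- predecessor of i inside a non-singleton block of R.  Conversely a maximal set of lanes S is
-- sent to the partition in which two gates used by S lie in one block iff no lane of S has
-- exactly one of them on its inner side.  Lanes from different blocks of a noncrossing partition
-- would separate those blocks, and lanes within one block only join cyclic neighbours, so the
-- lanes of R do not cross; they are maximal because a lane between two singletons crossing no
-- lane of R would let the singletons marry.  The two maps are mutually inverse, which gives the
-- equality of the two counts.

open import Defs
open import Data.Nat using (ℕ; _≤_)
open import Relation.Binary.PropositionalEquality using (_≡_)

open import Data.Nat using (zero; suc)
open import Data.Bool using (Bool; true; false)
open import Data.Empty using (⊥; ⊥-elim)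
open import Data.List using (List; []; _∷_; length; filter; map; concatMap; cartesianProductWith; _++_)
open import Data.List.Properties using (length-map; map-∘; map-id-local)
open import Data.List.Membership.Propositional using (_∈_)
open import Data.List.Membership.Propositional.Properties
  using (∈-filter⁺; ∈-filter⁻; ∈-map⁺; ∈-map⁻; ∈-cartesianProductWith⁺)
open import Data.List.Membership.Propositional.Properties.WithK using (unique∧set⇒bag)
open import Data.List.Relation.Binary.BagAndSetEquality using (_∼[_]_; set; ∼bag⇒↭)
open import Data.List.Relation.Binary.Permutation.Propositional.Properties using (↭-length)
open import Data.List.Relation.Unary.All as All using ([]; _∷_)
open import Data.List.Relation.Unary.All.Properties using (all-filter)
open import Data.List.Relation.Unary.Any using (here; there)
open import Data.List.Relation.Unary.AllPairs using ([]; _∷_)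
open import Data.List.Relation.Unary.Unique.Propositional using (Unique)
open import Data.List.Relation.Unary.Unique.Propositional.Properties
  using (map⁻; filter⁺; cartesianProductWith⁺)
open import Data.Product using (∃; ∃₂; _×_; _,_; proj₁; proj₂; swap)
import Data.Product as Product
open import Data.Sum using (_⊎_; inj₁; inj₂; [_,_]′)
import Data.Sum as Sum
open import Data.Vec using (Vec; []; _∷_; lookup; tabulate)
open import Data.Vec.Properties using (∷-injective; lookup∘tabulate; tabulate∘lookup; tabulate-cong)
open import Function using (_∘_)
open import Function.Bundles using (mk⇔)
open import Level using (0ℓ)
open import Relation.Binary.Core using (_⇒_; _⇔_)
open import Relation.Binary.Definitions using (tri<; tri≈; tri>)
open import Relation.Binary.PropositionalEquality using (_≢_; refl; sym; trans; cong; subst; module ≡-Reasoning)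
open import Relation.Nullary using (¬_; Dec; yes; no; does)
open import Relation.Nullary.Decidable using (dec-true; decidable-stable; ¬?; _×-dec_; _⊎-dec_; _→-dec_)
open import Relation.Unary using (Pred; Decidable)

count-≡-bijection : {A : Set} {P Q : Pred A 0ℓ} (P? : Decidable P) (Q? : Decidable Q) {xs : List A} →
                    Unique xs → (∀ x → x ∈ xs) → (f g : A → A) →
                    (∀ x → P x → Q (f x)) → (∀ y → Q y → P (g y)) →
                    (∀ x → P x → g (f x) ≡ x) → (∀ y → Q y → f (g y) ≡ y) →
                    count P? xs ≡ count Q? xs
count-≡-bijection P? Q? {xs} xs-unique complete f g f-into g-into g∘f f∘g = begin
  length (filter P? xs)
    ≡⟨ ↭-length (∼bag⇒↭ (unique∧set⇒bag (filter⁺ P? xs-unique) image-unique same-elements)) ⟩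
  length (map g (filter Q? xs))
    ≡⟨ length-map g (filter Q? xs) ⟩
  length (filter Q? xs)
    ∎
  where
  open ≡-Reasoning
  image-unique : Unique (map g (filter Q? xs))
  image-unique = map⁻ {f = f} (subst Unique (sym f∘g-on-image) (filter⁺ Q? xs-unique))
    where
    f∘g-on-image : map f (map g (filter Q? xs)) ≡ filter Q? xs
    f∘g-on-image = trans (sym (map-∘ (filter Q? xs))) (map-id-local (All.map (f∘g _) (all-filter Q? xs)))

  same-elements : filter P? xs ∼[ set ] map g (filter Q? xs)
  same-elements = mk⇔ into onto
    where
    into : ∀ {x} → x ∈ filter P? xs → x ∈ map g (filter Q? xs)
    into x∈ with px ← proj₂ (∈-filter⁻ P? {xs = xs} x∈) =
      subst (_∈ map g (filter Q? xs)) (g∘f _ px) (∈-map⁺ g (∈-filter⁺ Q? (complete _) (f-into _ px)))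
    onto : ∀ {x} → x ∈ map g (filter Q? xs) → x ∈ filter P? xs
    onto x∈ with y , y∈ , refl ← ∈-map⁻ g x∈ =
      ∈-filter⁺ P? (complete _) (g-into _ (proj₂ (∈-filter⁻ Q? {xs = xs} y∈)))

concatMap-map≡cartesianProductWith : {A B C : Set} (f : A → B → C) (xs : List A) (ys : List B) →
                                     concatMap (λ x → map (f x) ys) xs ≡ cartesianProductWith f xs ys
concatMap-map≡cartesianProductWith f []       ys = refl
concatMap-map≡cartesianProductWith f (x ∷ xs) ys =
  cong (map (f x) ys ++_) (concatMap-map≡cartesianProductWith f xs ys)

vecs≡cartesianProductWith : {A : Set} (xs : List A) (n : ℕ) →
                            vecs xs (suc n) ≡ cartesianProductWith _∷_ xs (vecs xs n)
vecs≡cartesianProductWith xs n = concatMap-map≡cartesianProductWith _∷_ xs (vecs xs n)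

vecs-unique : {A : Set} {xs : List A} → Unique xs → ∀ n → Unique (vecs xs n)
vecs-unique u zero    = [] ∷ []
vecs-unique {xs = xs} u (suc n) = subst Unique (sym (vecs≡cartesianProductWith xs n))
  (cartesianProductWith⁺ _∷_ ∷-injective u (vecs-unique u n))

∈-vecs : {A : Set} {xs : List A} → (∀ x → x ∈ xs) → ∀ {n} (v : Vec A n) → v ∈ vecs xs n
∈-vecs complete []      = here refl
∈-vecs {xs = xs} complete {suc n} (x ∷ v) = subst (x ∷ v ∈_) (sym (vecs≡cartesianProductWith xs n))
  (∈-cartesianProductWith⁺ _∷_ (complete x) (∈-vecs complete v))

allMatrices-unique : ∀ n → Unique (allMatrices n)
allMatrices-unique n = vecs-unique (vecs-unique (((λ ()) ∷ []) ∷ [] ∷ []) n) n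

∈-allMatrices : ∀ {n} (M : BoolMatrix n) → M ∈ allMatrices n
∈-allMatrices = ∈-vecs (∈-vecs λ { true → here refl ; false → there (here refl) })

module Chords where

  open import Data.Nat using (_<_; _*_; _⊓_; _⊔_; s≤s)
  open import Data.Nat.Properties

  Inner : ℕ → ℕ → ℕ → Set
  Inner p q r = p ⊓ q < r × r < p ⊔ q

  Outer : ℕ → ℕ → ℕ → Set
  Outer p q r = r < p ⊓ q ⊎ p ⊔ q < r

  interleave-sym : ∀ {a b c d} → Interleave a b c d → Interleave c d a b
  interleave-sym (inj₁ x) = inj₂ x
  interleave-sym (inj₂ x) = inj₁ x

  interleave-intro : ∀ {p q r s} → Inner p q r → Outer p q s → Interleave (p ⊓ q) (p ⊔ q) (r ⊓ s) (r ⊔ s)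
  interleave-intro {r = r} {s} (lo<r , r<hi) s-out with ≤-<-connex r s
  ... | inj₁ r≤s rewrite m≤n⇒m⊓n≡m r≤s | m≤n⇒m⊔n≡n r≤s with s-out
  ...   | inj₁ s<lo = ⊥-elim (<-asym s<lo (<-≤-trans lo<r r≤s))
  ...   | inj₂ hi<s = inj₁ (lo<r , r<hi , hi<s)
  interleave-intro {r = r} {s} (lo<r , r<hi) s-out | inj₂ s<r
    rewrite m≥n⇒m⊓n≡n (<⇒≤ s<r) | m≥n⇒m⊔n≡m (<⇒≤ s<r) with s-out
  ...   | inj₁ s<lo = inj₂ (s<lo , lo<r , r<hi)
  ...   | inj₂ hi<s = ⊥-elim (<-asym hi<s (<-trans s<r r<hi))

  interleave-intro′ : ∀ {p q r s} → Inner p q s → Outer p q r → Interleave (p ⊓ q) (p ⊔ q) (r ⊓ s) (r ⊔ s)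
  interleave-intro′ {r = r} {s} s-in r-out rewrite ⊓-comm r s | ⊔-comm r s = interleave-intro s-in r-out

  interleave-elim : ∀ {p q r s} → Interleave (p ⊓ q) (p ⊔ q) (r ⊓ s) (r ⊔ s) →
                    (Inner p q r × ¬ Inner p q s) ⊎ (¬ Inner p q r × Inner p q s)
  interleave-elim {r = r} {s} il with ≤-<-connex r s
  ... | inj₁ r≤s rewrite m≤n⇒m⊓n≡m r≤s | m≤n⇒m⊔n≡n r≤s with il
  ...   | inj₁ (a , b , c) = inj₁ ((a , b) , λ (_ , s<hi) → <-asym s<hi c)
  ...   | inj₂ (a , b , c) = inj₂ ((λ (lo<r , _) → <-asym lo<r a) , (b , c))
  interleave-elim {r = r} {s} il | inj₂ s<r
    rewrite m≥n⇒m⊓n≡n (<⇒≤ s<r) | m≥n⇒m⊔n≡m (<⇒≤ s<r) with il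
  ...   | inj₁ (a , b , c) = inj₂ ((λ (_ , r<hi) → <-asym r<hi c) , (a , b))
  ...   | inj₂ (a , b , c) = inj₁ ((b , c) , λ (lo<s , _) → <-asym lo<s a)

  ¬inner⇒outer : ∀ {p q r} → r ≢ p → r ≢ q → ¬ Inner p q r → Outer p q r
  ¬inner⇒outer {p} {q} {r} r≢p r≢q ¬inner with <-cmp r (p ⊓ q) | <-cmp r (p ⊔ q)
  ... | tri< r<lo _ _ | _            = inj₁ r<lo
  ... | tri≈ _ r≡lo _ | _            = ⊥-elim ([ r≢p , r≢q ]′ (Sum.map (trans r≡lo) (trans r≡lo) (⊓-sel p q)))
  ... | tri> _ _ lo<r | tri< r<hi _ _ = ⊥-elim (¬inner (lo<r , r<hi))
  ... | tri> _ _ _    | tri≈ _ r≡hi _ = ⊥-elim ([ r≢p , r≢q ]′ (Sum.map (trans r≡hi) (trans r≡hi) (⊔-sel p q)))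
  ... | tri> _ _ _    | tri> _ _ hi<r = inj₂ hi<r

  OnGate : ℕ → ℕ → Set
  OnGate m P = P ≡ 2 * m ⊎ P ≡ suc (2 * m)

  onGate-≢entry : ∀ {m P c} → OnGate m P → m ≢ c → P ≢ 2 * c
  onGate-≢entry {m} {c = c} (inj₁ refl) m≢c eq = m≢c (*-cancelˡ-≡ m c 2 eq)
  onGate-≢entry {m} {c = c} (inj₂ refl) _   eq = even≢odd c m (sym eq)

  onGate-≢exit : ∀ {m P d} → OnGate m P → m ≢ d → P ≢ suc (2 * d)
  onGate-≢exit {m} {d = d} (inj₁ refl) _   eq = even≢odd m d eq
  onGate-≢exit {m} {d = d} (inj₂ refl) m≢d eq = m≢d (*-cancelˡ-≡ m d 2 (suc-injective eq))

  private
    onGate-lower : ∀ {m P} → OnGate m P → 2 * m ≤ P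
    onGate-lower (inj₁ refl) = ≤-refl
    onGate-lower (inj₂ refl) = n≤1+n _

    onGate-upper : ∀ {m P} → OnGate m P → P ≤ suc (2 * m)
    onGate-upper (inj₁ refl) = n≤1+n _
    onGate-upper (inj₂ refl) = ≤-refl

    2a<1+2b⇒a≤b : ∀ {a b} → 2 * a < suc (2 * b) → a ≤ b
    2a<1+2b⇒a≤b (s≤s 2a≤2b) = *-cancelˡ-≤ 2 2a≤2b

    1+2a<1+2b⇒a<b : ∀ {a b} → suc (2 * a) < suc (2 * b) → a < b
    1+2a<1+2b⇒a<b {a} {b} (s≤s 2a<2b) = *-cancelˡ-< 2 a b 2a<2b

    a<b⇒1+2a<2b : ∀ {a b} → a < b → suc (2 * a) < 2 * b
    a<b⇒1+2a<2b {a} {b} a<b rewrite sym (*-suc 2 a) = *-monoʳ-≤ 2 a<b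

    chord-≤ : ∀ {c d} → c ≤ d → 2 * c ⊓ suc (2 * d) ≡ 2 * c × 2 * c ⊔ suc (2 * d) ≡ suc (2 * d)
    chord-≤ {c} {d} c≤d = m≤n⇒m⊓n≡m 2c≤1+2d , m≤n⇒m⊔n≡n 2c≤1+2d
      where
      2c≤1+2d : 2 * c ≤ suc (2 * d)
      2c≤1+2d = m≤n⇒m≤1+n (*-monoʳ-≤ 2 c≤d)

    chord-> : ∀ {c d} → d < c → 2 * c ⊓ suc (2 * d) ≡ suc (2 * d) × 2 * c ⊔ suc (2 * d) ≡ 2 * c
    chord-> {c} {d} d<c = m≥n⇒m⊓n≡n 1+2d≤2c , m≥n⇒m⊔n≡m 1+2d≤2c
      where
      1+2d≤2c : suc (2 * d) ≤ 2 * c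
      1+2d≤2c = <⇒≤ (a<b⇒1+2a<2b d<c)

  -- Gate m, that is positions 2m and 2m+1, lies weakly between the endpoints 2c and 2d+1 of lane (c , d).
  Spans : ℕ → ℕ → ℕ → Set
  Spans c d m = (c ≤ m × m ≤ d) ⊎ (d < m × m < c)

  inner⇒spans : ∀ {m P c d} → OnGate m P → Inner (2 * c) (suc (2 * d)) P → Spans c d m
  inner⇒spans {m} {c = c} {d} g inner with ≤-<-connex c d
  ... | inj₁ c≤d rewrite proj₁ (chord-≤ c≤d) | proj₂ (chord-≤ c≤d) =
    inj₁ ( 2a<1+2b⇒a≤b (<-≤-trans (proj₁ inner) (onGate-upper {m} g))
         , 2a<1+2b⇒a≤b (≤-<-trans (onGate-lower {m} g) (proj₂ inner)))
  ... | inj₂ d<c rewrite proj₁ (chord-> d<c) | proj₂ (chord-> d<c) =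
    inj₂ ( 1+2a<1+2b⇒a<b (<-≤-trans (proj₁ inner) (onGate-upper {m} g))
         , *-cancelˡ-< 2 _ _ (≤-<-trans (onGate-lower {m} g) (proj₂ inner)))

  spans⇒inner : ∀ {m P c d} → OnGate m P → P ≢ 2 * c → P ≢ suc (2 * d) → Spans c d m →
                Inner (2 * c) (suc (2 * d)) P
  spans⇒inner {m} g P≢entry P≢exit (inj₁ (c≤m , m≤d))
    rewrite proj₁ (chord-≤ (≤-trans c≤m m≤d)) | proj₂ (chord-≤ (≤-trans c≤m m≤d)) =
      ≤∧≢⇒< (≤-trans (*-monoʳ-≤ 2 c≤m) (onGate-lower {m} g)) (P≢entry ∘ sym)
    , ≤∧≢⇒< (≤-trans (onGate-upper {m} g) (s≤s (*-monoʳ-≤ 2 m≤d))) P≢exit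
  spans⇒inner {m} g _ _ (inj₂ (d<m , m<c))
    rewrite proj₁ (chord-> (<-trans d<m m<c)) | proj₂ (chord-> (<-trans d<m m<c)) =
    <-≤-trans (a<b⇒1+2a<2b d<m) (onGate-lower {m} g) , ≤-<-trans (onGate-upper {m} g) (a<b⇒1+2a<2b m<c)

open Chords

open import Data.Fin as Fin using (Fin; toℕ; zero; suc; _<_; _≟_)
open import Data.Fin.Properties
  using (<-cmp; <-irrefl; <-asym; <-trans; ≤∧≢⇒<; <⇒≢; toℕ-injective; _<?_; _≤?_; any?; all?)
import Data.Nat as ℕ
import Data.Nat.Properties as ℕ

⇔-trans : {n : ℕ} {R S T : Fin n → Fin n → Set} → R ⇔ S → S ⇔ T → R ⇔ T
⇔-trans (R⇒S , S⇒R) (S⇒T , T⇒S) = S⇒T ∘ R⇒S , S⇒R ∘ T⇒S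

fromRel : {n : ℕ} {R : Fin n → Fin n → Set} → (∀ i j → Dec (R i j)) → BoolMatrix n
fromRel R? = tabulate λ i → tabulate λ j → does (R? i j)

module _ {n : ℕ} {R : Fin n → Fin n → Set} (R? : ∀ i j → Dec (R i j)) where

  private
    lookup-fromRel : ∀ i j → lookup (lookup (fromRel R?) i) j ≡ does (R? i j)
    lookup-fromRel i j = trans (cong (λ row → lookup row j) (lookup∘tabulate _ i)) (lookup∘tabulate _ j)

    does-true : ∀ {A : Set} (a? : Dec A) → does a? ≡ true → A
    does-true (yes a) _ = a

  Entry-fromRel : Entry (fromRel R?) ⇔ R
  Entry-fromRel = (λ {i} {j} e → does-true (R? i j) (trans (sym (lookup-fromRel i j)) e))
                , (λ {i} {j} r → trans (lookup-fromRel i j) (dec-true (R? i j) r))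

BoolMatrix-ext : {n : ℕ} {M N : BoolMatrix n} → Entry M ⇔ Entry N → M ≡ N
BoolMatrix-ext {M = M} {N} (M⇒N , N⇒M) = Vec-ext λ i → Vec-ext λ j → Bool-ext M⇒N N⇒M
  where
  Vec-ext : ∀ {A : Set} {k} {u v : Vec A k} → (∀ i → lookup u i ≡ lookup v i) → u ≡ v
  Vec-ext {u = u} {v} eq = trans (sym (tabulate∘lookup u)) (trans (tabulate-cong eq) (tabulate∘lookup v))
  Bool-ext : ∀ {x y : Bool} → (x ≡ true → y ≡ true) → (y ≡ true → x ≡ true) → x ≡ y
  Bool-ext {true}  {true}  _ _ = refl
  Bool-ext {true}  {false} x⇒y _ = sym (x⇒y refl)
  Bool-ext {false} {true}  _ y⇒x = y⇒x refl
  Bool-ext {false} {false} _ _ = refl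

fromRel-≡ : {n : ℕ} {R : Fin n → Fin n → Set} (R? : ∀ i j → Dec (R i j)) {M : BoolMatrix n} →
            R ⇔ Entry M → fromRel R? ≡ M
fromRel-≡ R? R⇔M = BoolMatrix-ext (⇔-trans (Entry-fromRel R?) R⇔M)

IsEquivRel-resp-⇔ : {n : ℕ} {R R′ : Fin n → Fin n → Set} → R ⇔ R′ → IsEquivRel R → IsEquivRel R′
IsEquivRel-resp-⇔ (R⇒R′ , R′⇒R) (refl′ , sym′ , trans′) =
    (λ x → R⇒R′ (refl′ x))
  , (λ x y → R⇒R′ ∘ sym′ x y ∘ R′⇒R)
  , (λ x y z p q → R⇒R′ (trans′ x y z (R′⇒R p) (R′⇒R q)))

NonCrossing-resp-⇔ : {n : ℕ} {R R′ : Fin n → Fin n → Set} → R ⇔ R′ → NonCrossing R → NonCrossing R′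
NonCrossing-resp-⇔ (R⇒R′ , R′⇒R) noncrossing a b c d a<c c<b b<d (R′ab , R′cd , ¬R′ac) =
  noncrossing a b c d a<c c<b b<d (R′⇒R R′ab , R′⇒R R′cd , ¬R′ac ∘ R⇒R′)

Marriageable-resp-⇔ : {n : ℕ} {R R′ : Fin n → Fin n → Set} → R ⇔ R′ → Marriageable R → Marriageable R′
Marriageable-resp-⇔ (R⇒R′ , R′⇒R) (i , j , i≢j , i-single , j-single , merge-noncrossing) =
  i , j , i≢j , (λ x → i-single x ∘ R′⇒R) , (λ x → j-single x ∘ R′⇒R) ,
  NonCrossing-resp-⇔ (Sum.map₁ R⇒R′ , Sum.map₁ R′⇒R) merge-noncrossing

Between : {n : ℕ} → Fin n → Fin n → Fin n → Set
Between i j x = (i < x × x < j) ⊎ (j < x × x < i)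

Outside : {n : ℕ} → Fin n → Fin n → Fin n → Set
Outside i j x = (x < i × x < j) ⊎ (i < x × j < x)

Inside : {n : ℕ} → Fin n → Fin n → Fin n → Set
Inside c d m = Spans (toℕ c) (toℕ d) (toℕ m)

inside? : {n : ℕ} (c d m : Fin n) → Dec (Inside c d m)
inside? c d m = (c ≤? m ×-dec m ≤? d) ⊎-dec (d <? m ×-dec m <? c)

module _ {n : ℕ} {i j x : Fin n} where

  Between-sym : Between i j x → Between j i x
  Between-sym = Sum.swap

  Outside-sym : Outside i j x → Outside j i x
  Outside-sym = Sum.map swap swap

  Between-≢ : Between i j x → x ≢ i × x ≢ j
  Between-≢ (inj₁ (i<x , x<j)) = (<⇒≢ i<x ∘ sym) , <⇒≢ x<j
  Between-≢ (inj₂ (j<x , x<i)) = <⇒≢ x<i , (<⇒≢ j<x ∘ sym)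

  Outside-≢ : Outside i j x → x ≢ i × x ≢ j
  Outside-≢ (inj₁ (x<i , x<j)) = <⇒≢ x<i , <⇒≢ x<j
  Outside-≢ (inj₂ (i<x , j<x)) = (<⇒≢ i<x ∘ sym) , (<⇒≢ j<x ∘ sym)

  ¬between⇒outside : x ≢ i × x ≢ j → ¬ Between i j x → Outside i j x
  ¬between⇒outside (x≢i , x≢j) ¬between with <-cmp x i | <-cmp x j
  ... | tri≈ _ x≡i _ | _            = ⊥-elim (x≢i x≡i)
  ... | _            | tri≈ _ x≡j _ = ⊥-elim (x≢j x≡j)
  ... | tri< x<i _ _ | tri< x<j _ _ = inj₁ (x<i , x<j)
  ... | tri> _ _ i<x | tri> _ _ j<x = inj₂ (i<x , j<x)
  ... | tri< x<i _ _ | tri> _ _ j<x = ⊥-elim (¬between (inj₂ (j<x , x<i)))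
  ... | tri> _ _ i<x | tri< x<j _ _ = ⊥-elim (¬between (inj₁ (i<x , x<j)))

  between⇒inside : Between i j x → Inside i j x
  between⇒inside (inj₁ (i<x , x<j)) = inj₁ (ℕ.<⇒≤ i<x , ℕ.<⇒≤ x<j)
  between⇒inside (inj₂ j<x<i)       = inj₂ j<x<i

  inside⇒between : x ≢ i × x ≢ j → Inside i j x → Between i j x
  inside⇒between (x≢i , x≢j) (inj₁ (i≤x , x≤j)) = inj₁ (≤∧≢⇒< i≤x (x≢i ∘ sym) , ≤∧≢⇒< x≤j x≢j)
  inside⇒between _ (inj₂ j<x<i)       = inj₂ j<x<i

  outside⇒¬inside : Outside i j x → ¬ Inside i j x
  outside⇒¬inside (inj₁ (x<i , _))   (inj₁ (i≤x , _))   = ℕ.<⇒≱ x<i i≤x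
  outside⇒¬inside (inj₁ (_ , x<j))   (inj₂ (j<x , _))   = <-asym x<j j<x
  outside⇒¬inside (inj₂ (_ , j<x))   (inj₁ (_ , x≤j))   = ℕ.<⇒≱ j<x x≤j
  outside⇒¬inside (inj₂ (i<x , _))   (inj₂ (_ , x<i))   = <-asym i<x x<i

Inside-convex : {n : ℕ} {c d a b m : Fin n} → Inside c d a → Inside c d b → a Fin.≤ m → m Fin.≤ b → Inside c d m
Inside-convex (inj₁ (c≤a , _)) (inj₁ (_ , b≤d)) a≤m m≤b = inj₁ (ℕ.≤-trans c≤a a≤m , ℕ.≤-trans m≤b b≤d)
Inside-convex (inj₂ (d<a , _)) (inj₂ (_ , b<c)) a≤m m≤b = inj₂ (ℕ.<-≤-trans d<a a≤m , ℕ.≤-<-trans m≤b b<c)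
Inside-convex (inj₁ (c≤a , a≤d)) (inj₂ (d<b , b<c)) _ _ =
  ⊥-elim (ℕ.<⇒≱ (ℕ.<-trans d<b b<c) (ℕ.≤-trans c≤a a≤d))
Inside-convex (inj₂ (d<a , a<c)) (inj₁ (c≤b , b≤d)) _ _ =
  ⊥-elim (ℕ.<⇒≱ (ℕ.<-trans d<a a<c) (ℕ.≤-trans c≤b b≤d))

module _ {n : ℕ} {c d m : Fin n} where

  Inside-≤ : c Fin.≤ d → Inside c d m → c Fin.≤ m × m Fin.≤ d
  Inside-≤ _   (inj₁ c≤m≤d)       = c≤m≤d
  Inside-≤ c≤d (inj₂ (d<m , m<c)) = ⊥-elim (ℕ.<⇒≱ (ℕ.<-trans d<m m<c) c≤d)

  Inside-> : d < c → Inside c d m → d < m × m < c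
  Inside-> d<c (inj₁ (c≤m , m≤d)) = ⊥-elim (ℕ.<⇒≱ d<c (ℕ.≤-trans c≤m m≤d))
  Inside-> _   (inj₂ d<m<c)       = d<m<c

Inside-ends : {n : ℕ} {c d : Fin n} → (Inside c d c → Inside c d d) × (Inside c d d → Inside c d c)
Inside-ends = (λ { (inj₁ (_ , c≤d)) → inj₁ (c≤d , ℕ.≤-refl) ; (inj₂ (_ , c<c)) → ⊥-elim (ℕ.<-irrefl refl c<c) })
            , (λ { (inj₁ (c≤d , _)) → inj₁ (ℕ.≤-refl , c≤d) ; (inj₂ (d<d , _)) → ⊥-elim (ℕ.<-irrefl refl d<d) })

≢⇒toℕ≢ : {n : ℕ} {m x : Fin n} → m ≢ x → toℕ m ≢ toℕ x
≢⇒toℕ≢ m≢x = m≢x ∘ toℕ-injective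

module _ {n : ℕ} {i j x : Fin n} {P : ℕ} (onGate : OnGate (toℕ x) P) where

  inner⇒inside : Inner (entryPt i) (exitPt j) P → Inside i j x
  inner⇒inside = inner⇒spans onGate

  between⇒inner : Between i j x → Inner (entryPt i) (exitPt j) P
  between⇒inner b with Between-≢ b
  ... | x≢i , x≢j = spans⇒inner onGate (onGate-≢entry onGate (≢⇒toℕ≢ x≢i)) (onGate-≢exit onGate (≢⇒toℕ≢ x≢j))
                                (between⇒inside b)

  outside⇒outer : Outside i j x → Outer (entryPt i) (exitPt j) P
  outside⇒outer o with Outside-≢ o
  ... | x≢i , x≢j = ¬inner⇒outer (onGate-≢entry onGate (≢⇒toℕ≢ x≢i)) (onGate-≢exit onGate (≢⇒toℕ≢ x≢j))
                                 (outside⇒¬inside o ∘ inner⇒inside)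

  inner⇒between : x ≢ i × x ≢ j → Inner (entryPt i) (exitPt j) P → Between i j x
  inner⇒between x∉ij = inside⇒between x∉ij ∘ inner⇒inside

  ¬inner⇒outside : x ≢ i × x ≢ j → ¬ Inner (entryPt i) (exitPt j) P → Outside i j x
  ¬inner⇒outside x∉ij ¬inner = ¬between⇒outside x∉ij (¬inner ∘ between⇒inner)

LanesInterleave : {n : ℕ} → Fin n → Fin n → Fin n → Fin n → Set
LanesInterleave i j k l =
  Interleave (entryPt i ℕ.⊓ exitPt j) (entryPt i ℕ.⊔ exitPt j) (entryPt k ℕ.⊓ exitPt l) (entryPt k ℕ.⊔ exitPt l)

lanesCross? : {n : ℕ} (i j k l : Fin n) → Dec (LanesCross i j k l)
lanesCross? i j k l =
  i ≟ k ⊎-dec j ≟ l ⊎-dec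
    ((a ℕ.<? c ×-dec c ℕ.<? b ×-dec b ℕ.<? d) ⊎-dec (c ℕ.<? a ×-dec a ℕ.<? d ×-dec d ℕ.<? b))
  where
  a b c d : ℕ
  a = entryPt i ℕ.⊓ exitPt j
  b = entryPt i ℕ.⊔ exitPt j
  c = entryPt k ℕ.⊓ exitPt l
  d = entryPt k ℕ.⊔ exitPt l

Separates : {n : ℕ} → Fin n → Fin n → Fin n → Fin n → Set
Separates i j k l = (Between i j k × Outside i j l) ⊎ (Outside i j k × Between i j l)

Separates-sym : {n : ℕ} {i j k l : Fin n} → Separates i j k l → Separates j i k l
Separates-sym = Sum.map (Product.map Between-sym Outside-sym) (Product.map Outside-sym Between-sym)

Apart : {n : ℕ} → (Fin n → Fin n → Set) → Fin n → Fin n → Fin n → Fin n → Set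
Apart T x y u v = ∀ {a c} → (a ≡ x ⊎ a ≡ y) → (c ≡ u ⊎ c ≡ v) → ¬ T a c

Apart⇒disjoint : {n : ℕ} {T : Fin n → Fin n → Set} {x y u v : Fin n} →
                 (∀ a → T a a) → Apart T x y u v → Apart _≡_ x y u v
Apart⇒disjoint T-refl apart a∈ c∈ refl = apart a∈ c∈ (T-refl _)

separates⇒lanesInterleave : {n : ℕ} {i j k l : Fin n} → Separates i j k l → LanesInterleave i j k l
separates⇒lanesInterleave (inj₁ (k-between , l-outside)) =
  interleave-intro (between⇒inner (inj₁ refl) k-between) (outside⇒outer (inj₂ refl) l-outside)
separates⇒lanesInterleave (inj₂ (k-outside , l-between)) =
  interleave-intro′ (between⇒inner (inj₂ refl) l-between) (outside⇒outer (inj₁ refl) k-outside)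

disjoint⇒≢ : {n : ℕ} {i j k l : Fin n} → Apart _≡_ i j k l → (k ≢ i × k ≢ j) × (l ≢ i × l ≢ j)
disjoint⇒≢ disjoint = ( (λ k≡i → disjoint (inj₁ refl) (inj₁ refl) (sym k≡i))
                      , (λ k≡j → disjoint (inj₂ refl) (inj₁ refl) (sym k≡j)))
                    , ( (λ l≡i → disjoint (inj₁ refl) (inj₂ refl) (sym l≡i))
                      , (λ l≡j → disjoint (inj₂ refl) (inj₂ refl) (sym l≡j)))

lanesInterleave⇒separates : {n : ℕ} {i j k l : Fin n} → Apart _≡_ i j k l →
                            LanesInterleave i j k l → Separates i j k l
lanesInterleave⇒separates disjoint il with disjoint⇒≢ disjoint | interleave-elim il
... | k∉ij , l∉ij | inj₁ (k-inner , l-not-inner) =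
  inj₁ (inner⇒between (inj₁ refl) k∉ij k-inner , ¬inner⇒outside (inj₂ refl) l∉ij l-not-inner)
... | k∉ij , l∉ij | inj₂ (k-not-inner , l-inner) =
  inj₂ (¬inner⇒outside (inj₁ refl) k∉ij k-not-inner , inner⇒between (inj₂ refl) l∉ij l-inner)

module _ {n : ℕ} {T : Fin n → Fin n → Set}
         (T-noncrossing : NonCrossing T) (T-sym : ∀ {a b} → T a b → T b a) where

  private
    ¬between×outside : ∀ {x y u v} → T x y → T u v → Apart T x y u v → Between x y u → Outside x y v → ⊥
    ¬between×outside {x} {y} {u} {v} Txy Tuv apart (inj₁ (x<u , u<y)) (inj₁ (v<x , _)) =
      T-noncrossing v u x y v<x x<u u<y (T-sym Tuv , Txy , apart (inj₁ refl) (inj₂ refl) ∘ T-sym)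
    ¬between×outside {x} {y} {u} {v} Txy Tuv apart (inj₁ (x<u , u<y)) (inj₂ (_ , y<v)) =
      T-noncrossing x y u v x<u u<y y<v (Txy , Tuv , apart (inj₁ refl) (inj₁ refl))
    ¬between×outside {x} {y} {u} {v} Txy Tuv apart (inj₂ (y<u , u<x)) (inj₁ (_ , v<y)) =
      T-noncrossing v u y x v<y y<u u<x (T-sym Tuv , T-sym Txy , apart (inj₂ refl) (inj₂ refl) ∘ T-sym)
    ¬between×outside {x} {y} {u} {v} Txy Tuv apart (inj₂ (y<u , u<x)) (inj₂ (x<v , _)) =
      T-noncrossing y x u v y<u u<x x<v (T-sym Txy , Tuv , apart (inj₂ refl) (inj₁ refl))

  noncrossing⇒¬separates : ∀ {x y u v} → T x y → T u v → Apart T x y u v → ¬ Separates x y u v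
  noncrossing⇒¬separates Txy Tuv apart (inj₁ (u-between , v-outside)) =
    ¬between×outside Txy Tuv apart u-between v-outside
  noncrossing⇒¬separates Txy Tuv apart (inj₂ (u-outside , v-between)) =
    ¬between×outside Txy (T-sym Tuv) (λ a∈ c∈ → apart a∈ (Sum.swap c∈)) v-between u-outside

module _ {n : ℕ} {a b c d : Fin n} (¬cross : ¬ LanesCross a b c d) where

  -- By parity an entry is never an exit, so ¬cross only has to keep a ≢ c and b ≢ d.
  private
    entry-inner : Inside c d a → Inner (entryPt c) (exitPt d) (entryPt a)
    entry-inner = spans⇒inner (inj₁ refl) (onGate-≢entry (inj₁ refl) (≢⇒toℕ≢ (¬cross ∘ inj₁)))
                              (ℕ.even≢odd (toℕ a) (toℕ d))

    exit-inner : Inside c d b → Inner (entryPt c) (exitPt d) (exitPt b)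
    exit-inner = spans⇒inner (inj₂ refl) (ℕ.even≢odd (toℕ c) (toℕ b) ∘ sym)
                             (onGate-≢exit (inj₂ refl) (≢⇒toℕ≢ (¬cross ∘ inj₂ ∘ inj₁)))

    entry-outer : ¬ Inside c d a → Outer (entryPt c) (exitPt d) (entryPt a)
    entry-outer ¬inside = ¬inner⇒outer (onGate-≢entry (inj₁ refl) (≢⇒toℕ≢ (¬cross ∘ inj₁)))
                                       (ℕ.even≢odd (toℕ a) (toℕ d)) (¬inside ∘ inner⇒spans (inj₁ refl))

    exit-outer : ¬ Inside c d b → Outer (entryPt c) (exitPt d) (exitPt b)
    exit-outer ¬inside = ¬inner⇒outer (ℕ.even≢odd (toℕ c) (toℕ b) ∘ sym)
                                      (onGate-≢exit (inj₂ refl) (≢⇒toℕ≢ (¬cross ∘ inj₂ ∘ inj₁)))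
                                      (¬inside ∘ inner⇒spans (inj₂ refl))

  ¬lanesCross⇒inside⇔ : (Inside c d a → Inside c d b) × (Inside c d b → Inside c d a)
  ¬lanesCross⇒inside⇔ = entry⇒exit , exit⇒entry
    where
    entry⇒exit : Inside c d a → Inside c d b
    entry⇒exit a-inside with inside? c d b
    ... | yes b-inside = b-inside
    ... | no b-outside =
      ⊥-elim (¬cross (inj₂ (inj₂ (interleave-sym
        (interleave-intro (entry-inner a-inside) (exit-outer b-outside))))))

    exit⇒entry : Inside c d b → Inside c d a
    exit⇒entry b-inside with inside? c d a
    ... | yes a-inside = a-inside
    ... | no a-outside =
      ⊥-elim (¬cross (inj₂ (inj₂ (interleave-sym
        (interleave-intro′ (exit-inner b-inside) (entry-outer a-outside))))))

greatest : {n : ℕ} {P : Fin n → Set} → (∀ x → Dec (P x)) → ∀ {x} → P x →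
           ∃ λ m → P m × x Fin.≤ m × (∀ y → m < y → ¬ P y)
greatest {ℕ.suc n} P? {zero} px with any? (P? ∘ suc)
... | no none = zero , px , ℕ.z≤n , λ { zero () ; (suc y) _ py → none (y , py) }
... | yes (y , py) with greatest (P? ∘ suc) py
...   | m , pm , _ , above = suc m , pm , ℕ.z≤n , λ { zero () ; (suc y) (ℕ.s≤s m<y) → above y m<y }
greatest {ℕ.suc n} P? {suc x} px with greatest (P? ∘ suc) px
... | m , pm , x≤m , above = suc m , pm , ℕ.s≤s x≤m , λ { zero () ; (suc y) (ℕ.s≤s m<y) → above y m<y }

least : {n : ℕ} {P : Fin n → Set} → (∀ x → Dec (P x)) → ∀ {x} → P x →
        ∃ λ m → P m × m Fin.≤ x × (∀ y → y < m → ¬ P y)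
least {ℕ.suc n} P? {x} px with P? zero
... | yes p0 = zero , p0 , ℕ.z≤n , λ y ()
least {ℕ.suc n} P? {zero}  px | no ¬p0 = ⊥-elim (¬p0 px)
least {ℕ.suc n} P? {suc x} px | no ¬p0 with least (P? ∘ suc) px
... | m , pm , m≤x , below = suc m , pm , ℕ.s≤s m≤x , λ { zero _ → ¬p0 ; (suc y) (ℕ.s≤s y<m) → below y y<m }

StepDown : {n : ℕ} → (Fin n → Fin n → Set) → Fin n → Fin n → Set
StepDown R i j = j < i × (∀ m → j < m → m < i → ¬ R i m)

WrapAround : {n : ℕ} → (Fin n → Fin n → Set) → Fin n → Fin n → Set
WrapAround R i j = i < j × (∀ m → m < i → ¬ R i m) × (∀ m → j < m → ¬ R i m)

CyclicPred : {n : ℕ} → (Fin n → Fin n → Set) → Fin n → Fin n → Set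
CyclicPred R i j = R i j × (StepDown R i j ⊎ WrapAround R i j)

cyclicPred? : {n : ℕ} {R : Fin n → Fin n → Set} → (∀ x y → Dec (R x y)) → ∀ i j → Dec (CyclicPred R i j)
cyclicPred? R? i j =
  R? i j ×-dec
  ((j <? i ×-dec all? λ m → j <? m →-dec m <? i →-dec ¬? (R? i m)) ⊎-dec
   (i <? j ×-dec (all? λ m → m <? i →-dec ¬? (R? i m)) ×-dec (all? λ m → j <? m →-dec ¬? (R? i m))))

CyclicPred-irrefl : {n : ℕ} {R : Fin n → Fin n → Set} {i j : Fin n} → CyclicPred R i j → i ≢ j
CyclicPred-irrefl (_ , inj₁ (j<i , _)) refl = <-irrefl refl j<i
CyclicPred-irrefl (_ , inj₂ (i<j , _)) refl = <-irrefl refl i<j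

CyclicPred-resp-⇔ : {n : ℕ} {R R′ : Fin n → Fin n → Set} → R ⇔ R′ → CyclicPred R ⇒ CyclicPred R′
CyclicPred-resp-⇔ (R⇒R′ , R′⇒R) (Rij , inj₁ (j<i , gap)) =
  R⇒R′ Rij , inj₁ (j<i , λ m j<m m<i → gap m j<m m<i ∘ R′⇒R)
CyclicPred-resp-⇔ (R⇒R′ , R′⇒R) (Rij , inj₂ (i<j , below , above)) =
  R⇒R′ Rij , inj₂ (i<j , (λ m m<i → below m m<i ∘ R′⇒R) , (λ m j<m → above m j<m ∘ R′⇒R))

laneMatrix : {n : ℕ} → BoolMatrix n → BoolMatrix n
laneMatrix M = fromRel (cyclicPred? (entry? M))

Used : {n : ℕ} → (Fin n → Fin n → Set) → Fin n → Set
Used S m = (∃ λ x → S m x) ⊎ (∃ λ x → S x m)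

Unseparated : {n : ℕ} → (Fin n → Fin n → Set) → Fin n → Fin n → Set
Unseparated S i j = ∀ c d → S c d → (Inside c d i → Inside c d j) × (Inside c d j → Inside c d i)

SameBlock : {n : ℕ} → (Fin n → Fin n → Set) → Fin n → Fin n → Set
SameBlock S i j = i ≡ j ⊎ (Used S i × Used S j × Unseparated S i j)

sameBlock? : {n : ℕ} {S : Fin n → Fin n → Set} → (∀ x y → Dec (S x y)) → ∀ i j → Dec (SameBlock S i j)
sameBlock? {S = S} S? i j =
  i ≟ j ⊎-dec (used? i ×-dec used? j ×-dec
    (all? λ c → all? λ d → S? c d →-dec
      ((inside? c d i →-dec inside? c d j) ×-dec (inside? c d j →-dec inside? c d i))))
  where
  used? : ∀ m → Dec (Used S m)
  used? m = any? (S? m) ⊎-dec any? (λ x → S? x m)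

SameBlock-resp-⇔ : {n : ℕ} {S S′ : Fin n → Fin n → Set} → S ⇔ S′ → SameBlock S ⇒ SameBlock S′
SameBlock-resp-⇔ _ (inj₁ i≡j) = inj₁ i≡j
SameBlock-resp-⇔ {S = S} {S′} (S⇒S′ , S′⇒S) (inj₂ (i-used , j-used , unseparated)) =
  inj₂ (used′ i-used , used′ j-used , λ c d → unseparated c d ∘ S′⇒S)
  where
  used′ : ∀ {m} → Used S m → Used S′ m
  used′ = Sum.map (Product.map₂ S⇒S′) (Product.map₂ S⇒S′)

blockMatrix : {n : ℕ} → BoolMatrix n → BoolMatrix n
blockMatrix S = fromRel (sameBlock? (entry? S))

Merge-sym : {n : ℕ} {R : Fin n → Fin n → Set} {i j a b : Fin n} →
            (∀ {x y} → R x y → R y x) → Merge R i j a b → Merge R i j b a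
Merge-sym R-sym = Sum.map R-sym (Sum.swap ∘ Sum.map swap swap)

module PartitionLanes {n : ℕ} {R : Fin n → Fin n → Set} (R? : ∀ x y → Dec (R x y))
                      (R-equiv : IsEquivRel R) (R-noncrossing : NonCrossing R) where

  private
    R-refl : ∀ x → R x x
    R-refl = proj₁ R-equiv

    R-sym : ∀ {x y} → R x y → R y x
    R-sym = proj₁ (proj₂ R-equiv) _ _

    R-trans : ∀ {x y z} → R x y → R y z → R x z
    R-trans = proj₂ (proj₂ R-equiv) _ _ _

    blockLane : ∀ {v s p} → R v s → R v p → StepDown R s p ⊎ WrapAround R s p → CyclicPred R s p
    blockLane Rvs Rvp shape = R-trans (R-sym Rvs) Rvp , shape

  blocks-apart : ∀ {x y u v} → R x y → R u v → ¬ R x u → Apart R x y u v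
  blocks-apart Rxy Ruv ¬Rxu (inj₁ refl) (inj₁ refl) = ¬Rxu
  blocks-apart Rxy Ruv ¬Rxu (inj₁ refl) (inj₂ refl) = λ Rxv → ¬Rxu (R-trans Rxv (R-sym Ruv))
  blocks-apart Rxy Ruv ¬Rxu (inj₂ refl) (inj₁ refl) = λ Ryu → ¬Rxu (R-trans Rxy Ryu)
  blocks-apart Rxy Ruv ¬Rxu (inj₂ refl) (inj₂ refl) = λ Ryv → ¬Rxu (R-trans Rxy (R-trans Ryv (R-sym Ruv)))

  wrap-inside : ∀ {a b m} → WrapAround R a b → R a m → Inside a b m
  wrap-inside (_ , below , above) Ram = inj₁ (ℕ.≮⇒≥ (λ m<a → below _ m<a Ram) , ℕ.≮⇒≥ (λ b<m → above _ b<m Ram))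

  stepDown-¬inside : ∀ {c d m} → StepDown R c d → R c m → ¬ Inside c d m
  stepDown-¬inside (d<c , gap) Rcm inside with Inside-> d<c inside
  ... | d<m , m<c = gap _ d<m m<c Rcm

  cyclicPred-functional : ∀ {i j l} → CyclicPred R i j → CyclicPred R i l → j ≡ l
  cyclicPred-functional {j = j} {l} (Rij , inj₁ (j<i , gap-j)) (Ril , inj₁ (l<i , gap-l)) with <-cmp j l
  ... | tri< j<l _ _ = ⊥-elim (gap-j _ j<l l<i Ril)
  ... | tri≈ _ j≡l _ = j≡l
  ... | tri> _ _ l<j = ⊥-elim (gap-l _ l<j j<i Rij)
  cyclicPred-functional (Rij , inj₁ (j<i , _)) (_ , inj₂ (_ , below , _)) = ⊥-elim (below _ j<i Rij)
  cyclicPred-functional (_ , inj₂ (_ , below , _)) (Ril , inj₁ (l<i , _)) = ⊥-elim (below _ l<i Ril)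
  cyclicPred-functional {j = j} {l} (Rij , inj₂ (_ , _ , above-j)) (Ril , inj₂ (_ , _ , above-l)) with <-cmp j l
  ... | tri< j<l _ _ = ⊥-elim (above-j _ j<l Ril)
  ... | tri≈ _ j≡l _ = j≡l
  ... | tri> _ _ l<j = ⊥-elim (above-l _ l<j Rij)

  cyclicPred-injective : ∀ {i j k} → CyclicPred R i j → CyclicPred R k j → i ≡ k
  cyclicPred-injective {i} {j} {k} (Rij , i-step) (Rkj , k-step) = same-pred i-step k-step
    where
    Rik : R i k
    Rik = R-trans Rij (R-sym Rkj)

    same-pred : StepDown R i j ⊎ WrapAround R i j → StepDown R k j ⊎ WrapAround R k j → i ≡ k
    same-pred (inj₁ (j<i , gap-i)) (inj₁ (j<k , gap-k)) with <-cmp i k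
    ... | tri< i<k _ _ = ⊥-elim (gap-k i j<i i<k (R-sym Rik))
    ... | tri≈ _ i≡k _ = i≡k
    ... | tri> _ _ k<i = ⊥-elim (gap-i k j<k k<i Rik)
    same-pred (inj₁ (j<i , _)) (inj₂ (_ , _ , above-k)) = ⊥-elim (above-k i j<i (R-sym Rik))
    same-pred (inj₂ (_ , _ , above-i)) (inj₁ (j<k , _)) = ⊥-elim (above-i k j<k Rik)
    same-pred (inj₂ (_ , below-i , _)) (inj₂ (_ , below-k , _)) with <-cmp i k
    ... | tri< i<k _ _ = ⊥-elim (below-k i i<k (R-sym Rik))
    ... | tri≈ _ i≡k _ = i≡k
    ... | tri> _ _ k<i = ⊥-elim (below-i k k<i Rik)

  private
    sameBlock-¬interleave : ∀ {i j k l} → CyclicPred R i j → CyclicPred R k l → R i k → ¬ (i ≡ k × j ≡ l) →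
                            ¬ LanesInterleave i j k l
    sameBlock-¬interleave {i} {j} {k} {l} (Rij , inj₁ step) (Rkl , _) Rik _ il with interleave-elim il
    ... | inj₁ (k-inner , _) =
      stepDown-¬inside step Rik (inner⇒inside {i = i} {j} {k} (inj₁ refl) k-inner)
    ... | inj₂ (_ , l-inner) =
      stepDown-¬inside step (R-trans Rik Rkl) (inner⇒inside {i = i} {j} {l} (inj₂ refl) l-inner)
    sameBlock-¬interleave {i} {j} {k} {l} (Rij , inj₂ _) (Rkl , inj₁ step) Rik _ il
      with interleave-elim (interleave-sym il)
    ... | inj₁ (i-inner , _) =
      stepDown-¬inside step (R-sym Rik) (inner⇒inside {i = k} {l} {i} (inj₁ refl) i-inner)
    ... | inj₂ (_ , j-inner) =
      stepDown-¬inside step (R-trans (R-sym Rik) Rij) (inner⇒inside {i = k} {l} {j} (inj₂ refl) j-inner)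
    sameBlock-¬interleave {i} {j} {k} p@(_ , inj₂ (_ , i-min , _)) q@(_ , inj₂ (_ , k-min , _)) Rik ne _
      with <-cmp i k
    ... | tri< i<k _ _ = k-min i i<k (R-sym Rik)
    ... | tri≈ _ refl _ = ne (refl , cyclicPred-functional p q)
    ... | tri> _ _ k<i = i-min k k<i Rik

    differentBlocks-¬interleave : ∀ {i j k l} → CyclicPred R i j → CyclicPred R k l → ¬ R i k →
                                  ¬ LanesInterleave i j k l
    differentBlocks-¬interleave {i} {j} {k} {l} (Rij , _) (Rkl , _) ¬Rik il =
      noncrossing⇒¬separates R-noncrossing R-sym Rij Rkl apart
        (lanesInterleave⇒separates (Apart⇒disjoint R-refl apart) il)
      where
      apart : Apart R i j k l
      apart = blocks-apart Rij Rkl ¬Rik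

  cyclicPred-noncrossing : ∀ {i j k l} → CyclicPred R i j → CyclicPred R k l → ¬ (i ≡ k × j ≡ l) →
                           ¬ LanesCross i j k l
  cyclicPred-noncrossing p q ne (inj₁ refl)        = ne (refl , cyclicPred-functional p q)
  cyclicPred-noncrossing p q ne (inj₂ (inj₁ refl)) = ne (cyclicPred-injective p q , refl)
  cyclicPred-noncrossing {i} {k = k} p q ne (inj₂ (inj₂ il)) with R? i k
  ... | yes Rik = sameBlock-¬interleave p q Rik ne il
  ... | no ¬Rik = differentBlocks-¬interleave p q ¬Rik il

  cyclicPred-exists : ∀ {i x} → R i x → x ≢ i → ∃ (CyclicPred R i)
  cyclicPred-exists {i} Rix x≢i with any? (λ m → R? i m ×-dec m <? i)
  ... | yes (_ , below-i) with greatest (λ m → R? i m ×-dec m <? i) below-i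
  ...   | j , (Rij , j<i) , _ , above = j , Rij , inj₁ (j<i , λ m j<m m<i Rim → above m j<m (Rim , m<i))
  cyclicPred-exists {i} {x} Rix x≢i | no i-min with greatest (R? i) Rix
  ... | j , Rij , x≤j , above = j , Rij , inj₂ (i<j , (λ m m<i Rim → i-min (m , Rim , m<i)) , above)
    where
    i<j : i < j
    i<j = ℕ.<-≤-trans (≤∧≢⇒< (ℕ.≮⇒≥ λ x<i → i-min (x , Rix , x<i)) (x≢i ∘ sym)) x≤j

  cyclicSucc-exists : ∀ {j x} → R j x → x ≢ j → ∃ λ k → CyclicPred R k j
  cyclicSucc-exists {j} Rjx x≢j with any? (λ m → R? j m ×-dec j <? m)
  ... | yes (_ , above-j) with least (λ m → R? j m ×-dec j <? m) above-j
  ...   | k , (Rjk , j<k) , _ , below =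
    k , R-sym Rjk , inj₁ (j<k , λ m j<m m<k Rkm → below m m<k (R-trans Rjk Rkm , j<m))
  cyclicSucc-exists {j} {x} Rjx x≢j | no j-max with least (R? j) Rjx
  ... | k , Rjk , k≤x , below =
    k , R-sym Rjk ,
    inj₂ (k<j , (λ m m<k Rkm → below m m<k (R-trans Rjk Rkm)) , λ m j<m Rkm → j-max (m , R-trans Rjk Rkm , j<m))
    where
    k<j : k < j
    k<j = ℕ.≤-<-trans k≤x (≤∧≢⇒< (ℕ.≮⇒≥ λ j<x → j-max (x , Rjx , j<x)) x≢j)

  blockSpan : ∀ {i x} → R i x → x ≢ i → ∃₂ λ a b → R i a × R i b × WrapAround R a b
  blockSpan {i} {x} Rix x≢i with least (R? i) Rix | greatest (R? i) Rix
  ... | a , Ria , a≤x , below | b , Rib , x≤b , above =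
    a , b , Ria , Rib ,
    a<b , (λ m m<a Ram → below m m<a (R-trans Ria Ram)) , (λ m b<m Ram → above m b<m (R-trans Ria Ram))
    where
    a<b : a < b
    a<b with <-cmp x i
    ... | tri< x<i _ _ = ℕ.≤-<-trans a≤x (ℕ.<-≤-trans x<i (ℕ.≮⇒≥ λ b<i → above i b<i (R-refl i)))
    ... | tri≈ _ x≡i _ = ⊥-elim (x≢i x≡i)
    ... | tri> _ _ i<x = ℕ.≤-<-trans (ℕ.≮⇒≥ λ i<a → below i i<a (R-refl i)) (ℕ.<-≤-trans i<x x≤b)

  enclosingStep : ∀ {v a b j} → R v a → R v b → a < j → j < b → ¬ R v j →
                  ∃₂ λ s p → R v s × R v p × StepDown R s p × a Fin.≤ p × p < j × j < s × s Fin.≤ b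
  enclosingStep {v} {j = j} Rva Rvb a<j j<b ¬Rvj
    with greatest (λ m → R? v m ×-dec m <? j) (Rva , a<j) | least (λ m → R? v m ×-dec j <? m) (Rvb , j<b)
  ... | p , (Rvp , p<j) , a≤p , above | s , (Rvs , j<s) , s≤b , below =
    s , p , Rvs , Rvp , (<-trans p<j j<s , gap) , a≤p , p<j , j<s , s≤b
    where
    gap : ∀ m → p < m → m < s → ¬ R s m
    gap m p<m m<s Rsm with <-cmp m j
    ... | tri< m<j _ _ = above m p<m (R-trans Rvs Rsm , m<j)
    ... | tri≈ _ refl _ = ¬Rvj (R-trans Rvs Rsm)
    ... | tri> _ _ j<m = below m m<s (R-trans Rvs Rsm , j<m)

  separatingLane : ∀ {lo hi u v} → Singleton R lo → Singleton R hi → R u v → lo < v → v < hi → u < lo ⊎ hi < u →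
                   ∃₂ λ k l → CyclicPred R k l × Separates lo hi k l
  separatingLane {v = v} lo-single _ Ruv lo<v v<hi (inj₁ u<lo)
    with enclosingStep (R-sym Ruv) (R-refl v) u<lo lo<v (λ Rvlo → <⇒≢ lo<v (sym (lo-single v (R-sym Rvlo))))
  ... | s , p , Rvs , Rvp , step , _ , p<lo , lo<s , s≤v =
    s , p , blockLane Rvs Rvp (inj₁ step) ,
    inj₁ (inj₁ (lo<s , ℕ.≤-<-trans s≤v v<hi) , inj₁ (p<lo , <-trans p<lo (<-trans lo<v v<hi)))
  separatingLane {v = v} _ hi-single Ruv lo<v v<hi (inj₂ hi<u)
    with enclosingStep (R-refl v) (R-sym Ruv) v<hi hi<u (λ Rvhi → <⇒≢ v<hi (hi-single v (R-sym Rvhi)))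
  ... | s , p , Rvs , Rvp , step , v≤p , p<hi , hi<s , _ =
    s , p , blockLane Rvs Rvp (inj₁ step) ,
    inj₂ (inj₂ (<-trans (<-trans lo<v v<hi) hi<s , hi<s) , inj₁ (ℕ.<-≤-trans lo<v v≤p , p<hi))

  merge-noncrossing : ∀ {i j} → Singleton R i → Singleton R j →
                      ¬ (∃₂ λ k l → CyclicPred R k l × LanesCross i j k l) → NonCrossing (Merge R i j)
  merge-noncrossing {i} {j} i-single j-single no-crossing = noncrossing
    where
    unseparable : ∀ {lo hi u v} → (lo ≡ i × hi ≡ j) ⊎ (lo ≡ j × hi ≡ i) →
                  R u v → lo < v → v < hi → u < lo ⊎ hi < u → ⊥
    unseparable (inj₁ (refl , refl)) Ruv lo<v v<hi u-out
      with k , l , lane , sep ← separatingLane i-single j-single Ruv lo<v v<hi u-out =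
      no-crossing (k , l , lane , inj₂ (inj₂ (separates⇒lanesInterleave sep)))
    unseparable (inj₂ (refl , refl)) Ruv lo<v v<hi u-out
      with k , l , lane , sep ← separatingLane j-single i-single Ruv lo<v v<hi u-out =
      no-crossing (k , l , lane , inj₂ (inj₂ (separates⇒lanesInterleave (Separates-sym sep))))

    noncrossing : NonCrossing (Merge R i j)
    noncrossing a b c d a<c c<b b<d (inj₁ Rab , inj₁ Rcd , ¬Rac) =
      R-noncrossing a b c d a<c c<b b<d (Rab , Rcd , ¬Rac ∘ inj₁)
    noncrossing a b c d a<c c<b b<d (inj₁ Rab , inj₂ cd   , _)   = unseparable cd Rab c<b b<d (inj₁ a<c)
    noncrossing a b c d a<c c<b b<d (inj₂ ab   , inj₁ Rcd , _)   = unseparable ab (R-sym Rcd) a<c c<b (inj₂ b<d)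
    noncrossing _ _ _ _ a<c _ _ (inj₂ (inj₁ (refl , refl)) , inj₂ (inj₁ (refl , refl)) , _) = <-irrefl refl a<c
    noncrossing _ _ _ _ _ c<b _ (inj₂ (inj₁ (refl , refl)) , inj₂ (inj₂ (refl , refl)) , _) = <-irrefl refl c<b
    noncrossing _ _ _ _ _ c<b _ (inj₂ (inj₂ (refl , refl)) , inj₂ (inj₁ (refl , refl)) , _) = <-irrefl refl c<b
    noncrossing _ _ _ _ a<c _ _ (inj₂ (inj₂ (refl , refl)) , inj₂ (inj₂ (refl , refl)) , _) = <-irrefl refl a<c

  cyclicPred-maximal : ¬ Marriageable R → ∀ i j → i ≢ j → ∃₂ λ k l → CyclicPred R k l × LanesCross i j k l
  cyclicPred-maximal lonely i j i≢j with any? (λ x → R? i x ×-dec ¬? (x ≟ i))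
  ... | yes (_ , Rix , x≢i) with cyclicPred-exists Rix x≢i
  ...   | l , lane = i , l , lane , inj₁ refl
  cyclicPred-maximal lonely i j i≢j | no i-single with any? (λ x → R? j x ×-dec ¬? (x ≟ j))
  ... | yes (_ , Rjx , x≢j) with cyclicSucc-exists Rjx x≢j
  ...   | k , lane = k , j , lane , inj₂ (inj₁ refl)
  cyclicPred-maximal lonely i j i≢j | no i-single | no j-single
    with any? (λ k → any? λ l → cyclicPred? R? k l ×-dec lanesCross? i j k l)
  ... | yes crossing = crossing
  ... | no no-crossing =
    ⊥-elim (lonely (i , j , i≢j , i-single′ , j-single′ , merge-noncrossing i-single′ j-single′ no-crossing))
    where
    singleton : ∀ {z} → ¬ (∃ λ x → R z x × x ≢ z) → Singleton R z
    singleton {z} none x Rzx = decidable-stable (x ≟ z) (λ x≢z → none (x , Rzx , x≢z))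

    i-single′ : Singleton R i
    i-single′ = singleton i-single

    j-single′ : Singleton R j
    j-single′ = singleton j-single

  private
    ownBlock-inside : ∀ {c d u v} → CyclicPred R c d → R c u → R c v → Inside c d u → Inside c d v
    ownBlock-inside (_ , inj₁ step) Rcu _ u-inside = ⊥-elim (stepDown-¬inside step Rcu u-inside)
    ownBlock-inside (_ , inj₂ wrap) _ Rcv _ = wrap-inside wrap Rcv

    otherBlock-inside : ∀ {c d u v} → CyclicPred R c d → R u v → ¬ R c u → Inside c d u → Inside c d v
    otherBlock-inside {c} {d} {u} {v} (Rcd , _) Ruv ¬Rcu u-inside with inside? c d v
    ... | yes v-inside = v-inside
    ... | no v-outside = ⊥-elim (noncrossing⇒¬separates R-noncrossing R-sym Rcd Ruv apart
          (inj₁ (inside⇒between u∉cd u-inside , ¬between⇒outside v∉cd (v-outside ∘ between⇒inside))))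
      where
      apart : Apart R c d u v
      apart = blocks-apart Rcd Ruv ¬Rcu

      u∉cd : u ≢ c × u ≢ d
      u∉cd = proj₁ (disjoint⇒≢ (Apart⇒disjoint R-refl apart))

      v∉cd : v ≢ c × v ≢ d
      v∉cd = proj₂ (disjoint⇒≢ (Apart⇒disjoint R-refl apart))

  related⇒unseparated : ∀ {i j} → R i j → Unseparated (CyclicPred R) i j
  related⇒unseparated {i} {j} Rij c d lane with R? c i
  ... | yes Rci = ownBlock-inside lane Rci (R-trans Rci Rij) , ownBlock-inside lane (R-trans Rci Rij) Rci
  ... | no ¬Rci =
    otherBlock-inside lane Rij ¬Rci , otherBlock-inside lane (R-sym Rij) (λ Rcj → ¬Rci (R-trans Rcj (R-sym Rij)))

  related⇒sameBlock : ∀ {i j} → R i j → SameBlock (CyclicPred R) i j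
  related⇒sameBlock {i} {j} Rij with j ≟ i
  ... | yes refl = inj₁ refl
  ... | no j≢i =
    inj₂ ( inj₁ (cyclicPred-exists Rij j≢i)
         , inj₁ (cyclicPred-exists (R-sym Rij) (j≢i ∘ sym))
         , related⇒unseparated Rij)

  -- The wrap lane of i's block has j inside, hence j lies strictly between two elements of the block;
  -- the step lane of the block around j then has j inside but not i.
  unrelated⇒separated : ∀ {i j x} → R i x → x ≢ i → ¬ R i j → ¬ Unseparated (CyclicPred R) i j
  unrelated⇒separated {i} {j} Rix x≢i ¬Rij unseparated with blockSpan Rix x≢i
  ... | a , b , Ria , Rib , wrap
    with Inside-≤ (ℕ.<⇒≤ (proj₁ wrap))
           (proj₁ (unseparated a b (blockLane Ria Rib (inj₂ wrap))) (wrap-inside wrap (R-sym Ria)))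
  ...   | a≤j , j≤b
    with enclosingStep Ria Rib (≤∧≢⇒< a≤j λ { refl → ¬Rij Ria }) (≤∧≢⇒< j≤b λ { refl → ¬Rij Rib }) ¬Rij
  ...     | s , p , Ris , Rip , step , _ , p<j , j<s , _ =
    stepDown-¬inside step (R-sym Ris) (proj₂ (unseparated s p (blockLane Ris Rip (inj₁ step))) (inj₂ (p<j , j<s)))

  sameBlock⇒related : ∀ {i j} → SameBlock (CyclicPred R) i j → R i j
  sameBlock⇒related (inj₁ refl) = R-refl _
  sameBlock⇒related {i} {j} (inj₂ (i-used , _ , unseparated)) with R? i j
  ... | yes Rij = Rij
  ... | no ¬Rij with i-used
  ...   | inj₁ (_ , lane) =
    ⊥-elim (unrelated⇒separated (proj₁ lane) (CyclicPred-irrefl {R = R} lane ∘ sym) ¬Rij unseparated)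
  ...   | inj₂ (_ , lane) =
    ⊥-elim (unrelated⇒separated (R-sym (proj₁ lane)) (CyclicPred-irrefl {R = R} lane) ¬Rij unseparated)

  sameBlock-cyclicPred⇔ : SameBlock (CyclicPred R) ⇔ R
  sameBlock-cyclicPred⇔ = sameBlock⇒related , related⇒sameBlock

module LaneBlocks {n : ℕ} {S : Fin n → Fin n → Set} (S? : ∀ x y → Dec (S x y))
                  (no-U-turn : ∀ i j → S i j → ¬ i ≡ j)
                  (S-noncrossing : ∀ i j k l → S i j → S k l → ¬ (i ≡ k × j ≡ l) → ¬ LanesCross i j k l) where

  private
    G : Fin n → Fin n → Set
    G = SameBlock S

  lane-unseparated : ∀ {a b} → S a b → Unseparated S a b
  lane-unseparated {a} {b} Sab c d Scd with a ≟ c ×-dec b ≟ d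
  ... | yes (refl , refl) = Inside-ends
  ... | no ends-differ = ¬lanesCross⇒inside⇔ (S-noncrossing _ _ _ _ Sab Scd ends-differ)

  lane⇒sameBlock : ∀ {a b} → S a b → G a b
  lane⇒sameBlock {a} {b} Sab = inj₂ (inj₁ (b , Sab) , inj₂ (a , Sab) , lane-unseparated Sab)

  sameBlock-sym : ∀ {x y} → G x y → G y x
  sameBlock-sym (inj₁ x≡y) = inj₁ (sym x≡y)
  sameBlock-sym (inj₂ (x-used , y-used , unseparated)) = inj₂ (y-used , x-used , λ c d → swap ∘ unseparated c d)

  sameBlock-equiv : IsEquivRel G
  sameBlock-equiv = (λ _ → inj₁ refl) , (λ _ _ → sameBlock-sym) , (λ _ _ _ → sameBlock-trans)
    where
    sameBlock-trans : ∀ {x y z} → G x y → G y z → G x z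
    sameBlock-trans (inj₁ refl) Gyz = Gyz
    sameBlock-trans Gxy (inj₁ refl) = Gxy
    sameBlock-trans (inj₂ (x-used , _ , x~y)) (inj₂ (_ , z-used , y~z)) =
      inj₂ (x-used , z-used , λ c d Scd →
        proj₁ (y~z c d Scd) ∘ proj₁ (x~y c d Scd) , proj₂ (x~y c d Scd) ∘ proj₂ (y~z c d Scd))

  sameBlock-noncrossing : NonCrossing G
  sameBlock-noncrossing a b c d a<c c<b b<d (inj₁ refl , _ , _) = <-asym a<c c<b
  sameBlock-noncrossing a b c d a<c c<b b<d (_ , inj₁ refl , _) = <-asym c<b b<d
  sameBlock-noncrossing a b c d a<c c<b b<d (inj₂ (a-used , _ , a~b) , inj₂ (c-used , _ , c~d) , ¬a~c) =
    ¬a~c (inj₂ (a-used , c-used , λ x y Sxy →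
      (λ a-inside → Inside-convex a-inside (proj₁ (a~b x y Sxy) a-inside) (ℕ.<⇒≤ a<c) (ℕ.<⇒≤ c<b)) ,
      (λ c-inside → proj₂ (a~b x y Sxy)
        (Inside-convex c-inside (proj₁ (c~d x y Sxy) c-inside) (ℕ.<⇒≤ c<b) (ℕ.<⇒≤ b<d)))))

  lane⇒cyclicPred : ∀ {a b} → S a b → CyclicPred G a b
  lane⇒cyclicPred {a} {b} Sab with <-cmp a b
  ... | tri≈ _ a≡b _ = ⊥-elim (no-U-turn a b Sab a≡b)
  ... | tri> _ _ b<a = lane⇒sameBlock Sab , inj₁ (b<a , gap)
    where
    gap : ∀ m → b < m → m < a → ¬ G a m
    gap m _ m<a (inj₁ refl) = <-irrefl refl m<a
    gap m b<m m<a (inj₂ (_ , _ , a~m)) =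
      <-irrefl refl (proj₂ (Inside-> b<a (proj₂ (a~m a b Sab) (inj₂ (b<m , m<a)))))
  ... | tri< a<b _ _ = lane⇒sameBlock Sab , inj₂ (a<b , below , above)
    where
    ends-inside : ∀ {m} → G a m → a Fin.≤ m × m Fin.≤ b
    ends-inside (inj₁ refl) = ℕ.≤-refl , ℕ.<⇒≤ a<b
    ends-inside (inj₂ (_ , _ , a~m)) = Inside-≤ (ℕ.<⇒≤ a<b) (proj₁ (a~m a b Sab) (inj₁ (ℕ.≤-refl , ℕ.<⇒≤ a<b)))

    below : ∀ m → m < a → ¬ G a m
    below m m<a = ℕ.<⇒≱ m<a ∘ proj₁ ∘ ends-inside

    above : ∀ m → b < m → ¬ G a m
    above m b<m = ℕ.<⇒≱ b<m ∘ proj₂ ∘ ends-inside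

  private
    singleton⇒unused : ∀ {a} → Singleton G a → ¬ Used S a
    singleton⇒unused a-single (inj₁ (x , Sax)) = no-U-turn _ _ Sax (sym (a-single x (lane⇒sameBlock Sax)))
    singleton⇒unused a-single (inj₂ (x , Sxa)) =
      no-U-turn _ _ Sxa (a-single x (sameBlock-sym (lane⇒sameBlock Sxa)))

  sameBlock-lonely : (∀ i j → i ≢ j → ¬ S i j → ∃₂ λ k l → S k l × LanesCross i j k l) → ¬ Marriageable G
  sameBlock-lonely maximal (i , j , i≢j , i-single , j-single , merge-noncrossing)
    with maximal i j i≢j (λ Sij → singleton⇒unused i-single (inj₁ (j , Sij)))
  ... | k , l , Skl , inj₁ refl        = singleton⇒unused i-single (inj₁ (l , Skl))
  ... | k , l , Skl , inj₂ (inj₁ refl) = singleton⇒unused j-single (inj₂ (k , Skl))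
  ... | k , l , Skl , inj₂ (inj₂ il)   =
    noncrossing⇒¬separates merge-noncrossing (Merge-sym sameBlock-sym)
      (inj₂ (inj₁ (refl , refl))) (inj₁ (lane⇒sameBlock Skl)) apart
      (lanesInterleave⇒separates (Apart⇒disjoint (λ _ → inj₁ (inj₁ refl)) apart) il)
    where
    single : ∀ {a} → a ≡ i ⊎ a ≡ j → Singleton G a
    single (inj₁ refl) = i-single
    single (inj₂ refl) = j-single

    used : ∀ {c} → c ≡ k ⊎ c ≡ l → Used S c
    used (inj₁ refl) = inj₁ (l , Skl)
    used (inj₂ refl) = inj₂ (k , Skl)

    apart : Apart (Merge G i j) i j k l
    apart a∈ c∈ (inj₁ Gac) = singleton⇒unused (single a∈) (subst (Used S) (single a∈ _ Gac) (used c∈))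
    apart _  c∈ (inj₂ (inj₁ (_ , refl))) = singleton⇒unused j-single (used c∈)
    apart _  c∈ (inj₂ (inj₂ (_ , refl))) = singleton⇒unused i-single (used c∈)

  cyclicPred-sameBlock⇔ : (∀ i j → i ≢ j → ¬ S i j → ∃₂ λ k l → S k l × LanesCross i j k l) → CyclicPred G ⇔ S
  cyclicPred-sameBlock⇔ maximal = lane-of-partition , lane⇒cyclicPred
    where
    open PartitionLanes (sameBlock? S?) sameBlock-equiv sameBlock-noncrossing

    lane-of-partition : CyclicPred G ⇒ S
    lane-of-partition {i} {j} lane with S? i j
    ... | yes Sij = Sij
    ... | no ¬Sij with maximal i j (CyclicPred-irrefl {R = G} lane) ¬Sij
    ...   | k , l , Skl , cross =
      ⊥-elim (cyclicPred-noncrossing lane (lane⇒cyclicPred Skl) (λ { (refl , refl) → ¬Sij Skl }) cross)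

laneMatrix-isMSL : {n : ℕ} (M : BoolMatrix n) → IsLonely M → IsMSL (laneMatrix M)
laneMatrix-isMSL M (equiv , noncrossing , lonely) =
    (λ _ _ → CyclicPred-irrefl {R = Entry M} ∘ to)
  , (λ _ _ _ _ lane lane′ → cyclicPred-noncrossing (to lane) (to lane′))
  , λ i j i≢j _ → let k , l , lane , cross = cyclicPred-maximal lonely i j i≢j in k , l , from lane , cross
  where
  open PartitionLanes (entry? M) equiv noncrossing
  to : Entry (laneMatrix M) ⇒ CyclicPred (Entry M)
  to = proj₁ (Entry-fromRel (cyclicPred? (entry? M)))

  from : CyclicPred (Entry M) ⇒ Entry (laneMatrix M)
  from = proj₂ (Entry-fromRel (cyclicPred? (entry? M)))

blockMatrix-isLonely : {n : ℕ} (S : BoolMatrix n) → IsMSL S → IsLonely (blockMatrix S)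
blockMatrix-isLonely S (no-U-turn , noncrossing , maximal) =
    IsEquivRel-resp-⇔ blocks⇔ sameBlock-equiv
  , NonCrossing-resp-⇔ blocks⇔ sameBlock-noncrossing
  , sameBlock-lonely maximal ∘ Marriageable-resp-⇔ (swap blocks⇔)
  where
  open LaneBlocks (entry? S) no-U-turn noncrossing
  blocks⇔ : SameBlock (Entry S) ⇔ Entry (blockMatrix S)
  blocks⇔ = swap (Entry-fromRel (sameBlock? (entry? S)))

laneMatrix∘blockMatrix : {n : ℕ} (S : BoolMatrix n) → IsMSL S → laneMatrix (blockMatrix S) ≡ S
laneMatrix∘blockMatrix S (no-U-turn , noncrossing , maximal) =
  fromRel-≡ (cyclicPred? (entry? (blockMatrix S)))
    (⇔-trans (CyclicPred-resp-⇔ blocks⇔ , CyclicPred-resp-⇔ (swap blocks⇔)) (cyclicPred-sameBlock⇔ maximal))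
  where
  open LaneBlocks (entry? S) no-U-turn noncrossing
  blocks⇔ : Entry (blockMatrix S) ⇔ SameBlock (Entry S)
  blocks⇔ = Entry-fromRel (sameBlock? (entry? S))

blockMatrix∘laneMatrix : {n : ℕ} (M : BoolMatrix n) → IsLonely M → blockMatrix (laneMatrix M) ≡ M
blockMatrix∘laneMatrix M (equiv , noncrossing , _) =
  fromRel-≡ (sameBlock? (entry? (laneMatrix M)))
    (⇔-trans (SameBlock-resp-⇔ lanes⇔ , SameBlock-resp-⇔ (swap lanes⇔)) sameBlock-cyclicPred⇔)
  where
  open PartitionLanes (entry? M) equiv noncrossing
  lanes⇔ : Entry (laneMatrix M) ⇔ CyclicPred (Entry M)
  lanes⇔ = Entry-fromRel (cyclicPred? (entry? M))

corollary19 : (n : ℕ) → 1 ≤ n → numMSL n ≡ L n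
corollary19 n _ =
  sym (count-≡-bijection isLonely? isMSL? (allMatrices-unique n) ∈-allMatrices laneMatrix blockMatrix
         laneMatrix-isMSL blockMatrix-isLonely blockMatrix∘laneMatrix laneMatrix∘blockMatrix)
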